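{- Let $k$ be a positive integer and let $T=(V,E)$ be a tree with at least $k$ edges and $|V|\ge \gamma(T)+k$. Then $k\le Sb_k(T)\le 2k$. Moreover, both bounds are sharp: for every positive integer $k$ there is a tree $T_1$ satisfying these hypotheses with $Sb_k(T_1)=k$ and a tree $T_2$ satisfying these hypotheses with $Sb_k(T_2)=2k$.
   Context: $\gamma(G)$ is the domination number of $G$ (minimum size of a dominating set). For a positive integer $k$, $Sb_k(G)$ is the minimum size of a set $\mathcal{E}$ of edges of $G$ such that $\gamma(G-\mathcal{E})=\gamma(G)+k$. -}

module Defs where

open import Data.Nat using (ℕ; zero; suc; _+_; _*_; _≤_; _<ᵇ_)
open import Data.Bool using (Bool; true; false; _∧_; not; if_then_else_)
open import Data.Fin using (Fin; toℕ)
open import Data.Fin.Subset using (Subset; _∈_; ∣_∣)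
open import Data.List using (List; []; _∷_; map; length)
open import Data.Nat.ListAction using (sum)
open import Data.List.Base using (allFin)
open import Data.List.Relation.Unary.Linked using (Linked)
open import Data.List.Relation.Unary.Unique.Propositional using (Unique)
open import Data.Product using (Σ; ∃; _×_; _,_)
open import Data.Sum using (_⊎_)
open import Relation.Nullary using (¬_)
open import Relation.Binary.PropositionalEquality using (_≡_; refl)

record Graph (n : ℕ) : Set where
  field
    adj    : Fin n → Fin n → Bool
    sym    : ∀ i j → adj i j ≡ adj j i
    irrefl : ∀ i → adj i i ≡ false
open Graph public

Adj : ∀ {n} → Graph n → Fin n → Fin n → Set
Adj G u v = adj G u v ≡ true

edgeCount : ∀ {n} → Graph n → ℕ
edgeCount {n} G =
  sum (map (λ i → sum (map (λ j → if (toℕ i <ᵇ toℕ j) ∧ adj G i j then 1 else 0)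
                           (allFin n)))
           (allFin n))

data Walk {n} (G : Graph n) : Fin n → Fin n → Set where
  [] : ∀ {u} → Walk G u u
  _∷_ : ∀ {u w v} → Adj G u w → Walk G w v → Walk G u v

Connected : ∀ {n} → Graph n → Set
Connected G = ∀ u v → Walk G u v

-- a cycle: at least 3 distinct vertices v0 … vm, consecutive ones adjacent, vm adjacent to v0
record Cycle {n} (G : Graph n) : Set where
  field
    first : Fin n
    rest  : List (Fin n)
    last  : Fin n
    long  : 1 ≤ length rest
    linked : Linked (Adj G) (first ∷ rest Data.List.++ (last ∷ []))
    distinct : Unique (first ∷ rest Data.List.++ (last ∷ []))
    closes : Adj G last first

Acyclic : ∀ {n} → Graph n → Set
Acyclic G = ¬ Cycle G

IsTree : ∀ {n} → Graph n → Set
IsTree {n} G = 1 ≤ n × Connected G × Acyclic G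

Dominating : ∀ {n} → Graph n → Subset n → Set
Dominating G D = ∀ v → v ∈ D ⊎ ∃ λ u → u ∈ D × Adj G u v

IsDomNum : ∀ {n} → Graph n → ℕ → Set
IsDomNum {n} G g =
  (∃ λ (D : Subset n) → Dominating G D × ∣ D ∣ ≡ g) ×
  (∀ (D : Subset n) → Dominating G D → g ≤ ∣ D ∣)

-- edge sets of G, represented as spanning subgraphs F of G
_⊆E_ : ∀ {n} → Graph n → Graph n → Set
F ⊆E G = ∀ i j → Adj F i j → Adj G i j

_─_ : ∀ {n} → Graph n → Graph n → Graph n
adj (G ─ F) i j = adj G i j ∧ not (adj F i j)
sym (G ─ F) i j rewrite sym G i j | sym F i j = refl
irrefl (G ─ F) i rewrite irrefl G i = refl

RaisesBy : ∀ {n} → Graph n → Graph n → ℕ → Set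
RaisesBy G F k = ∀ g → IsDomNum G g → IsDomNum (G ─ F) (g + k)

IsSb : ∀ {n} → ℕ → Graph n → ℕ → Set
IsSb {n} k G m =
  (∃ λ (F : Graph n) → F ⊆E G × RaisesBy G F k × edgeCount F ≡ m) ×
  (∀ (F : Graph n) → F ⊆E G → RaisesBy G F k → m ≤ edgeCount F)

Hyp : ∀ {n} → ℕ → Graph n → Set
Hyp {n} k T = IsTree T × k ≤ edgeCount T × (∀ g → IsDomNum T g → g + k ≤ n)

-- Deleting one edge raises γ by at most one: adding an endpoint of the edge to a minimum dominating
-- set repairs it. Hence raising γ by k costs at least k edges. Conversely, in a forest with an edge
-- and γ < n, a longest path ends either in a leaf whose neighbour has degree at most two, or in a
-- vertex carrying two leaves. Deleting one edge at the two leaves, or at most two edges at the end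
-- of the path, raises γ by exactly one, so k rounds raise γ by exactly k with at most 2k edges.
-- Both bounds are attained: in the star K₁,ₖ deleting all k edges raises γ from 1 to k + 1, and in
-- the corona of a path on k + 1 vertices γ = k + 1 = n / 2, so raising γ by k forces γ = n − 1,
-- which is impossible while two edges survive; thus 2k of the 2k + 1 edges must go.

module Submission where

open import Defs hiding (sym)
open import Data.Bool using (Bool; true; false; _∧_; _∨_; not; if_then_else_)
open import Data.Bool.Properties using (T-≡; ¬-not; ∧-conicalˡ; ∧-conicalʳ; ∨-comm; ∨-identityʳ; ∨-zeroʳ; ∧-identityʳ; ∧-zeroʳ) renaming (_≟_ to _≟ᵇ_)
open import Data.Empty using (⊥)
open import Data.Fin using (Fin; toℕ; fromℕ<; punchIn) renaming (zero to fzero; suc to fsuc; _<_ to _<ᶠ_)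
open import Data.Fin.Properties using (any?; all?; punchInᵢ≢i; toℕ-injective; toℕ-fromℕ<; toℕ<n; injective⇒≤) renaming (_≟_ to _≟ᶠ_; <-cmp to <ᶠ-cmp)
open import Data.Fin.Subset using (Subset; _∈_; _∉_; ∣_∣; ⊤; ⁅_⁆; _∪_; _-_; inside; outside)
open import Data.Fin.Subset.Properties using (_∈?_; ∣p∣≤n; ∣⊤∣≡n; ∈⊤; p⊆q⇒∣p∣≤∣q∣; x∈p∪q⁺; x∈⁅x⁆; ∣⁅x⁆∣≡1; x∈p∧x≢y⇒x∈p-y; x∈p⇒∣p-x∣<∣p∣; anySubset?; ∪-identityʳ; ∣p∣≤∣x∷p∣; drop-there)
open import Data.List using (List; []; _∷_; _++_; length; lookup; map; allFin; tabulate)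
open import Data.List.Properties using (map-tabulate)
open import Data.List.Membership.Propositional using () renaming (_∈_ to _∈ₗ_; _∉_ to _∉ₗ_)
open import Data.List.Membership.Propositional.Properties using (∈-∃++; ∈-lookup; ∈-++⁺ʳ)
open import Data.List.Relation.Unary.All as All using (All; []; _∷_)
open import Data.List.Relation.Unary.All.Properties using (++⁻ˡ; ++⁻ʳ; ++⁺)
open import Data.List.Relation.Unary.AllPairs as AllPairs using (AllPairs; []; _∷_)
open import Data.List.Relation.Unary.Any using (here; there)
open import Data.List.Relation.Unary.Linked as Linked using (Linked; []; [-]; _∷_)
open import Data.List.Relation.Unary.Linked.Properties using (Linked⇒All)
open import Data.List.Relation.Unary.Unique.Propositional using (Unique)
open import Data.Nat using (ℕ; zero; suc; _+_; _*_; _≤_; _<_; _<ᵇ_; z≤n; s≤s; z<s)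
open import Data.Nat.ListAction using () renaming (sum to sumList)
open import Data.Nat.Properties
open import Algebra.Properties.CommutativeMonoid.Sum +-0-commutativeMonoid using (sum; sum-syntax; sum-cong-≗; ∑-distrib-+; ∑-comm; sum-remove; sum-replicate-zero)
open import Data.Nat.Solver using (module +-*-Solver)
open import Data.Product using (Σ; ∃; _×_; _,_; proj₁; proj₂; map₂)
open import Data.Sum using (_⊎_; inj₁; inj₂; [_,_]′; swap) renaming (map to map⊎)
open import Data.Unit using (tt) renaming (⊤ to ⊤′)
open import Data.Vec as Vec using (Vec; []; _∷_)
open import Data.Vec.Properties using (lookup∘tabulate)
open import Function using (_∘_; id; flip; case_of_)
open import Function.Bundles using (mk⇔; module Equivalence)
open import Relation.Binary.Definitions using (tri<; tri≈; tri>)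
open import Relation.Binary.PropositionalEquality using (_≡_; _≢_; refl; sym; trans; cong; cong₂; subst; module ≡-Reasoning)
open import Relation.Nullary using (¬_; Dec; yes; no; does; ¬?; contradiction)
open import Relation.Nullary.Decidable using (_⊎-dec_; _×-dec_; does-⇔; dec-true; dec-false; decidable-stable)
open import Relation.Unary using (Decidable)

private
  variable
    n : ℕ

Adj-sym : (G : Graph n) {i j : Fin n} → Adj G i j → Adj G j i
Adj-sym G {i} {j} = trans (Graph.sym G j i)

Adj-irrefl : (G : Graph n) {i : Fin n} → ¬ Adj G i i
Adj-irrefl G {i} e with () ← trans (sym e) (irrefl G i)

Adj⇒≢ : (G : Graph n) {i j : Fin n} → Adj G i j → i ≢ j
Adj⇒≢ G e refl = Adj-irrefl G e

Adj? : (G : Graph n) → ∀ i j → Dec (Adj G i j)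
Adj? G i j = adj G i j ≟ᵇ true

Edgeless : Graph n → Set
Edgeless G = ∀ i j → ¬ Adj G i j

edge? : (G : Graph n) → Dec (∃ λ i → ∃ λ j → Adj G i j)
edge? G = any? λ i → any? λ j → Adj? G i j

─-⊆E : (G F : Graph n) → (G ─ F) ⊆E G
─-⊆E G F i j = ∧-conicalˡ _ _

─-Adj⁻ : (G F : Graph n) {i j : Fin n} → Adj (G ─ F) i j → ¬ Adj F i j
─-Adj⁻ G F {i} {j} e f with adj F i j
─-Adj⁻ G F e refl | true with () ← ∧-conicalʳ (adj G _ _) false e

─-Adj⁺ : (G F : Graph n) {i j : Fin n} → Adj G i j → ¬ Adj F i j → Adj (G ─ F) i j
─-Adj⁺ G F {i} {j} g f rewrite g | ¬-not f = refl

─-mono : (G F H : Graph n) → F ⊆E H → (G ─ H) ⊆E (G ─ F)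
─-mono G F H F⊆H i j e = ─-Adj⁺ G F (─-⊆E G H i j e) (─-Adj⁻ G H e ∘ F⊆H i j)

does≡true⇒ : {P : Set} (p : Dec P) → does p ≡ true → P
does≡true⇒ (yes p) _ = p

SameEnds : (a b i j : Fin n) → Set
SameEnds a b i j = (i ≡ a × j ≡ b) ⊎ (i ≡ b × j ≡ a)

SameEnds-swap : ∀ {a b i j : Fin n} → SameEnds a b i j → SameEnds a b j i
SameEnds-swap (inj₁ (p , q)) = inj₂ (q , p)
SameEnds-swap (inj₂ (p , q)) = inj₁ (q , p)

sameEnds? : (a b i j : Fin n) → Dec (SameEnds a b i j)
sameEnds? a b i j = (i ≟ᶠ a ×-dec j ≟ᶠ b) ⊎-dec (i ≟ᶠ b ×-dec j ≟ᶠ a)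

edge : (a b : Fin n) → a ≢ b → Graph n
adj (edge a b _) i j = does (sameEnds? a b i j)
Graph.sym (edge a b _) i j =
  does-⇔ (mk⇔ SameEnds-swap SameEnds-swap) (sameEnds? a b i j) (sameEnds? a b j i)
irrefl (edge a b a≢b) i = dec-false (sameEnds? a b i i) λ where
  (inj₁ (refl , refl)) → a≢b refl
  (inj₂ (refl , refl)) → a≢b refl

module _ {a b : Fin n} (a≢b : a ≢ b) where

  edge-Adj⁺ : ∀ {i j} → SameEnds a b i j → Adj (edge a b a≢b) i j
  edge-Adj⁺ = dec-true (sameEnds? a b _ _)

  edge-Adj : Adj (edge a b a≢b) a b
  edge-Adj = edge-Adj⁺ (inj₁ (refl , refl))

  edge-Adj⁻ : ∀ {i j} → Adj (edge a b a≢b) i j → SameEnds a b i j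
  edge-Adj⁻ {i} {j} = does≡true⇒ (sameEnds? a b i j)

  edge-adj≡false : ∀ {i j} → ¬ SameEnds a b i j → adj (edge a b a≢b) i j ≡ false
  edge-adj≡false = dec-false (sameEnds? a b _ _)

_∪E_ : Graph n → Graph n → Graph n
adj (F ∪E E) i j = adj F i j ∨ adj E i j
Graph.sym (F ∪E E) i j rewrite Graph.sym F i j | Graph.sym E i j = refl
irrefl (F ∪E E) i rewrite irrefl F i | irrefl E i = refl

∪E-Adj⁻ : (F E : Graph n) {i j : Fin n} → Adj (F ∪E E) i j → Adj F i j ⊎ Adj E i j
∪E-Adj⁻ F E {i} {j} e with adj F i j
... | true = inj₁ refl
... | false = inj₂ e

∪E-⊆ˡ : (F E : Graph n) → F ⊆E (F ∪E E)
∪E-⊆ˡ F E i j Fij rewrite Fij = refl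

edgeTerm : Graph n → Fin n → Fin n → ℕ
edgeTerm G i j = if (toℕ i <ᵇ toℕ j) ∧ adj G i j then 1 else 0

sumList-tabulate : (f : Fin n → ℕ) → sumList (tabulate f) ≡ sum f
sumList-tabulate {zero} f = refl
sumList-tabulate {suc n} f = cong (f fzero +_) (sumList-tabulate (f ∘ fsuc))

sumList-allFin : (f : Fin n → ℕ) → sumList (map f (allFin n)) ≡ sum f
sumList-allFin f = trans (cong sumList (map-tabulate id f)) (sumList-tabulate f)

edgeCount≡∑ : (G : Graph n) → edgeCount G ≡ ∑[ i < n ] ∑[ j < n ] edgeTerm G i j
edgeCount≡∑ {n} G =
  trans (sumList-allFin {n} λ i → sumList (map (edgeTerm G i) (allFin n))) (sum-cong-≗ λ i → sumList-allFin (edgeTerm G i))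

edgeCount-cong : (G H : Graph n) → (∀ i j → adj G i j ≡ adj H i j) → edgeCount G ≡ edgeCount H
edgeCount-cong {n} G H G≗H = begin
  edgeCount G                           ≡⟨ edgeCount≡∑ G ⟩
  ∑[ i < n ] ∑[ j < n ] edgeTerm G i j  ≡⟨ sum-cong-≗ (λ i → sum-cong-≗ λ j → cong (term i j) (G≗H i j)) ⟩
  ∑[ i < n ] ∑[ j < n ] edgeTerm H i j  ≡⟨ edgeCount≡∑ H ⟨
  edgeCount H                           ∎
  where
  open ≡-Reasoning
  term : Fin _ → Fin _ → Bool → ℕ
  term i j x = if (toℕ i <ᵇ toℕ j) ∧ x then 1 else 0

edgeCount-edgeless : (G : Graph n) → Edgeless G → edgeCount G ≡ 0
edgeCount-edgeless {n} G none = begin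
  edgeCount G                           ≡⟨ edgeCount≡∑ G ⟩
  ∑[ i < n ] ∑[ j < n ] edgeTerm G i j  ≡⟨ sum-cong-≗ (λ i → trans (sum-cong-≗ (noTerm i)) (sum-replicate-zero n)) ⟩
  ∑[ i < n ] 0                          ≡⟨ sum-replicate-zero n ⟩
  0                                     ∎
  where
  open ≡-Reasoning
  noTerm : ∀ i j → edgeTerm G i j ≡ 0
  noTerm i j rewrite ¬-not (none i j) | ∧-zeroʳ (toℕ i <ᵇ toℕ j) = refl

edgeCount-split : (G F : Graph n) → F ⊆E G → edgeCount G ≡ edgeCount (G ─ F) + edgeCount F
edgeCount-split {n} G F F⊆G = begin
  edgeCount G
    ≡⟨ edgeCount≡∑ G ⟩
  ∑[ i < n ] ∑[ j < n ] edgeTerm G i j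
    ≡⟨ sum-cong-≗ (λ i → trans (sum-cong-≗ (splitTerm i)) (∑-distrib-+ (edgeTerm (G ─ F) i) (edgeTerm F i))) ⟩
  ∑[ i < n ] (∑[ j < n ] edgeTerm (G ─ F) i j + ∑[ j < n ] edgeTerm F i j)
    ≡⟨ ∑-distrib-+ (λ i → ∑[ j < n ] edgeTerm (G ─ F) i j) (λ i → ∑[ j < n ] edgeTerm F i j) ⟩
  ∑[ i < n ] ∑[ j < n ] edgeTerm (G ─ F) i j + ∑[ i < n ] ∑[ j < n ] edgeTerm F i j
    ≡⟨ cong₂ _+_ (edgeCount≡∑ (G ─ F)) (edgeCount≡∑ F) ⟨
  edgeCount (G ─ F) + edgeCount F
    ∎
  where
  open ≡-Reasoning
  splitTerm : ∀ i j → edgeTerm G i j ≡ edgeTerm (G ─ F) i j + edgeTerm F i j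
  splitTerm i j with toℕ i <ᵇ toℕ j | adj F i j in f | adj G i j in g
  ... | false | _     | _     = refl
  ... | true  | false | true  = refl
  ... | true  | false | false = refl
  ... | true  | true  | true  = refl
  ... | true  | true  | false with () ← trans (sym (F⊆G i j f)) g

<⇒<ᵇ≡true : ∀ {m k} → m < k → (m <ᵇ k) ≡ true
<⇒<ᵇ≡true = Equivalence.to T-≡ ∘ <⇒<ᵇ

<ᵇ≡true⇒< : ∀ {m k} → (m <ᵇ k) ≡ true → m < k
<ᵇ≡true⇒< {m} {k} m<ᵇk = <ᵇ⇒< m k (Equivalence.from T-≡ m<ᵇk)

≥⇒<ᵇ≡false : ∀ {m k} → k ≤ m → (m <ᵇ k) ≡ false
≥⇒<ᵇ≡false k≤m = ¬-not λ m<ᵇk → <⇒≱ (<ᵇ≡true⇒< m<ᵇk) k≤m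

sum-suc-at : (f g : Fin n → ℕ) (x : Fin n) → f x ≡ suc (g x) → (∀ y → y ≢ x → f y ≡ g y) →
             sum f ≡ suc (sum g)
sum-suc-at {suc n} f g x fx≡ f≗g = begin
  sum f                                  ≡⟨ sum-remove {i = x} f ⟩
  f x + sum (f ∘ punchIn x)              ≡⟨ cong₂ _+_ fx≡ (sum-cong-≗ λ y → f≗g (punchIn x y) (punchInᵢ≢i x y)) ⟩
  suc (g x + sum (g ∘ punchIn x))        ≡⟨ cong suc (sum-remove {i = x} g) ⟨
  suc (sum g)                            ∎
  where open ≡-Reasoning

∑-one : ∀ m → ∑[ j < m ] 1 ≡ m
∑-one zero    = refl
∑-one (suc m) = cong suc (∑-one m)

SameEnds-flip : ∀ {a b i j : Fin n} → SameEnds a b i j → SameEnds b a i j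
SameEnds-flip (inj₁ p) = inj₂ p
SameEnds-flip (inj₂ p) = inj₁ p

record OneEdgeMore (G₁ G₂ : Graph n) (a b : Fin n) : Set where
  field
    agree : ∀ i j → ¬ SameEnds a b i j → adj G₂ i j ≡ adj G₁ i j
    old   : ¬ Adj G₁ a b
    new   : Adj G₂ a b

OneEdgeMore-flip : {G₁ G₂ : Graph n} {a b : Fin n} → OneEdgeMore G₁ G₂ a b → OneEdgeMore G₁ G₂ b a
OneEdgeMore-flip {G₁ = G₁} {G₂} e = record
  { agree = λ i j ¬ba → agree i j (¬ba ∘ SameEnds-flip)
  ; old   = old ∘ Adj-sym G₁
  ; new   = Adj-sym G₂ new
  }
  where open OneEdgeMore e

private
  edgeCount-OneEdgeMore< : {G₁ G₂ : Graph n} {a b : Fin n} → OneEdgeMore G₁ G₂ a b →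
                           toℕ a < toℕ b → edgeCount G₂ ≡ suc (edgeCount G₁)
  edgeCount-OneEdgeMore< {n} {G₁} {G₂} {a} {b} e a<b = begin
    edgeCount G₂                                 ≡⟨ edgeCount≡∑ G₂ ⟩
    ∑[ i < n ] ∑[ j < n ] edgeTerm G₂ i j        ≡⟨ sum-suc-at _ _ a (sum-suc-at _ _ b termAt otherColumns) otherRows ⟩
    suc (∑[ i < n ] ∑[ j < n ] edgeTerm G₁ i j)  ≡⟨ cong suc (edgeCount≡∑ G₁) ⟨
    suc (edgeCount G₁)                           ∎
    where
    open OneEdgeMore e
    open ≡-Reasoning
    term≗ : ∀ i j → ¬ (i ≡ a × j ≡ b) → edgeTerm G₂ i j ≡ edgeTerm G₁ i j
    term≗ i j ¬ab with i ≟ᶠ b | j ≟ᶠ a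
    ... | yes refl | yes refl rewrite ≥⇒<ᵇ≡false (<⇒≤ a<b) = refl
    ... | no i≢b | _ rewrite agree i j [ ¬ab , (λ (i≡b , _) → i≢b i≡b) ]′ = refl
    ... | yes _ | no j≢a rewrite agree i j [ ¬ab , (λ (_ , j≡a) → j≢a j≡a) ]′ = refl
    termAt : edgeTerm G₂ a b ≡ suc (edgeTerm G₁ a b)
    termAt rewrite <⇒<ᵇ≡true a<b | new | ¬-not old = refl
    otherColumns : ∀ j → j ≢ b → edgeTerm G₂ a j ≡ edgeTerm G₁ a j
    otherColumns j j≢b = term≗ a j λ (_ , j≡b) → j≢b j≡b
    otherRows : ∀ i → i ≢ a → ∑[ j < n ] edgeTerm G₂ i j ≡ ∑[ j < n ] edgeTerm G₁ i j
    otherRows i i≢a = sum-cong-≗ λ j → term≗ i j λ (i≡a , _) → i≢a i≡a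

edgeCount-OneEdgeMore : {G₁ G₂ : Graph n} {a b : Fin n} → OneEdgeMore G₁ G₂ a b →
                        edgeCount G₂ ≡ suc (edgeCount G₁)
edgeCount-OneEdgeMore {G₂ = G₂} {a = a} {b} e with <-cmp (toℕ a) (toℕ b)
... | tri< a<b _ _ = edgeCount-OneEdgeMore< e a<b
... | tri≈ _ a≡b _ = contradiction (toℕ-injective a≡b) (Adj⇒≢ G₂ (OneEdgeMore.new e))
... | tri> _ _ b<a = edgeCount-OneEdgeMore< (OneEdgeMore-flip e) b<a

OneEdgeMore-─edge : (F : Graph n) {a b : Fin n} (ab : Adj F a b) →
                    OneEdgeMore (F ─ edge a b (Adj⇒≢ F ab)) F a b
OneEdgeMore-─edge F {a} {b} ab = record
  { agree = λ i j ¬ab → sym (trans (cong (λ x → adj F i j ∧ not x) (edge-adj≡false a≢b ¬ab)) (∧-identityʳ _))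
  ; old   = λ ab′ → ─-Adj⁻ F (edge a b a≢b) ab′ (edge-Adj a≢b)
  ; new   = ab
  }
  where a≢b = Adj⇒≢ F ab

OneEdgeMore-∪edge : (F : Graph n) {a b : Fin n} (a≢b : a ≢ b) → ¬ Adj F a b →
                    OneEdgeMore F (F ∪E edge a b a≢b) a b
OneEdgeMore-∪edge F {a} {b} a≢b ¬ab = record
  { agree = λ i j ¬ab → trans (cong (adj F i j ∨_) (edge-adj≡false a≢b ¬ab)) (∨-identityʳ _)
  ; old   = ¬ab
  ; new   = trans (cong (adj F a b ∨_) (edge-Adj a≢b)) (∨-zeroʳ _)
  }

Least : (ℕ → Set) → ℕ → Set
Least P k = P k × (∀ {j} → P j → k ≤ j)

module _ {P : ℕ → Set} (P? : Decidable P) where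

  private
    searchFrom : ∀ i d → (∀ {j} → j < i → ¬ P j) → P (d + i) → ∃ (Least P)
    searchFrom i d below p with P? i
    ... | yes pᵢ = i , pᵢ , λ pⱼ → ≮⇒≥ λ j<i → below j<i pⱼ
    searchFrom i zero below p | no ¬pᵢ = contradiction p ¬pᵢ
    searchFrom i (suc d) below p | no ¬pᵢ = searchFrom (suc i) d below′ (subst P (sym (+-suc d i)) p)
      where
      below′ : ∀ {j} → j < suc i → ¬ P j
      below′ j<1+i with m<1+n⇒m<n∨m≡n j<1+i
      ... | inj₁ j<i = below j<i
      ... | inj₂ refl = ¬pᵢ

  least : ∀ {m} → P m → ∃ (Least P)
  least {m} p = searchFrom 0 m (λ ()) (subst P (sym (+-identityʳ m)) p)

∣p∪⁅x⁆∣≤1+∣p∣ : (p : Subset n) (x : Fin n) → ∣ p ∪ ⁅ x ⁆ ∣ ≤ suc ∣ p ∣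
∣p∪⁅x⁆∣≤1+∣p∣ (inside ∷ p)  fzero    rewrite ∪-identityʳ p = n≤1+n _
∣p∪⁅x⁆∣≤1+∣p∣ (outside ∷ p) fzero    rewrite ∪-identityʳ p = ≤-refl
∣p∪⁅x⁆∣≤1+∣p∣ (inside ∷ p)  (fsuc x) = s≤s (∣p∪⁅x⁆∣≤1+∣p∣ p x)
∣p∪⁅x⁆∣≤1+∣p∣ (outside ∷ p) (fsuc x) = ∣p∪⁅x⁆∣≤1+∣p∣ p x

∀∈⇒∣p∣≡n : (p : Subset n) → (∀ x → x ∈ p) → ∣ p ∣ ≡ n
∀∈⇒∣p∣≡n {n} p all∈ = ≤-antisym (∣p∣≤n p) (subst (_≤ ∣ p ∣) (∣⊤∣≡n n) (p⊆q⇒∣p∣≤∣q∣ {p = ⊤} λ {x} _ → all∈ x))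

∈⇒1≤∣p∣ : {p : Subset n} {x : Fin n} → x ∈ p → 1 ≤ ∣ p ∣
∈⇒1≤∣p∣ x∈p = ≤-trans (s≤s z≤n) (x∈p⇒∣p-x∣<∣p∣ x∈p)

dominating? : (G : Graph n) → Decidable (Dominating G)
dominating? G D = all? λ v → v ∈? D ⊎-dec any? λ u → u ∈? D ×-dec Adj? G u v

DominatedBy : Graph n → ℕ → Set
DominatedBy G c = ∃ λ D → Dominating G D × ∣ D ∣ ≡ c

Least-DominatedBy⇒IsDomNum : (G : Graph n) {g : ℕ} → Least (DominatedBy G) g → IsDomNum G g
Least-DominatedBy⇒IsDomNum G (dom , min) = dom , λ D d → min (D , d , refl)

domNum-exists : (G : Graph n) → ∃ (IsDomNum G)
domNum-exists {n} G = map₂ (Least-DominatedBy⇒IsDomNum G) (least dominatedBy? (⊤ , (λ _ → inj₁ ∈⊤) , ∣⊤∣≡n n))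
  where
  dominatedBy? : Decidable (DominatedBy G)
  dominatedBy? c = anySubset? λ D → dominating? G D ×-dec ∣ D ∣ ≟ c

domNum-unique : (G : Graph n) {g h : ℕ} → IsDomNum G g → IsDomNum G h → g ≡ h
domNum-unique G ((D , d , refl) , min) ((E , e , refl) , min′) = ≤-antisym (min E e) (min′ D d)

Dominating-mono : (G H : Graph n) → G ⊆E H → ∀ D → Dominating G D → Dominating H D
Dominating-mono G H G⊆H D dom v with dom v
... | inj₁ v∈D = inj₁ v∈D
... | inj₂ (u , u∈D , uv) = inj₂ (u , u∈D , G⊆H u v uv)

domNum-mono : (G H : Graph n) → G ⊆E H → {g h : ℕ} → IsDomNum G g → IsDomNum H h → h ≤ g
domNum-mono G H G⊆H ((D , d , refl) , _) (_ , min) = min D (Dominating-mono G H G⊆H D d)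

domNum-cong : (G H : Graph n) → G ⊆E H → H ⊆E G → {g : ℕ} → IsDomNum G g → IsDomNum H g
domNum-cong G H G⊆H H⊆G ((D , d , ∣D∣≡g) , min) =
  (D , Dominating-mono G H G⊆H D d , ∣D∣≡g) , λ E e → min E (Dominating-mono H G H⊆G E e)

domNum-edgeless : (G : Graph n) → Edgeless G → IsDomNum G n
domNum-edgeless {n} G none = (⊤ , (λ _ → inj₁ ∈⊤) , ∣⊤∣≡n n) , λ D d → ≤-reflexive (sym (∀∈⇒∣p∣≡n D (all∈ D d)))
  where
  all∈ : ∀ D → Dominating G D → ∀ x → x ∈ D
  all∈ D d x with d x
  ... | inj₁ x∈D = x∈D
  ... | inj₂ (u , _ , ux) = contradiction ux (none u x)

-- Lower bound

record DeletesAtMost (H H′ : Graph n) (a b : Fin n) : Set where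
  field
    ⊆E-orig : H′ ⊆E H
    lost    : ∀ i j → Adj H i j → ¬ Adj H′ i j → SameEnds a b i j

domNum-DeletesAtMost : {H H′ : Graph n} {a b : Fin n} → DeletesAtMost H H′ a b →
                       {g g′ : ℕ} → IsDomNum H g → IsDomNum H′ g′ → g′ ≤ suc g
domNum-DeletesAtMost {n} {H} {H′} {a} {b} del ((D , dom , refl) , _) (_ , min′) =
  ≤-trans (min′ (D ∪ ⁅ c (a ∈? D) ⁆) dom′) (∣p∪⁅x⁆∣≤1+∣p∣ D (c (a ∈? D)))
  where
  open DeletesAtMost del
  c : Dec (a ∈ D) → Fin n
  c (yes _) = b
  c (no _)  = a
  ∈D′ : ∀ {x y} → x ∈ D → x ∈ D ∪ ⁅ y ⁆
  ∈D′ x∈D = x∈p∪q⁺ (inj₁ x∈D)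
  y∈D′ : ∀ y → y ∈ D ∪ ⁅ y ⁆
  y∈D′ y = x∈p∪q⁺ (inj₂ (x∈⁅x⁆ y))
  dom′ : Dominating H′ (D ∪ ⁅ c (a ∈? D) ⁆)
  dom′ v with dom v
  ... | inj₁ v∈D = inj₁ (∈D′ v∈D)
  ... | inj₂ (u , u∈D , uv) with Adj? H′ u v
  ...   | yes uv′ = inj₂ (u , ∈D′ u∈D , uv′)
  ...   | no ¬uv′ with lost u v uv ¬uv′ | a ∈? D
  ...     | inj₁ (refl , refl) | yes _   = inj₁ (y∈D′ b)
  ...     | inj₁ (refl , refl) | no a∉D  = contradiction u∈D a∉D
  ...     | inj₂ (refl , refl) | yes a∈D = inj₁ (∈D′ a∈D)
  ...     | inj₂ (refl , refl) | no _    = inj₁ (y∈D′ a)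

DeletesAtMost-─edge : (F : Graph n) {a b : Fin n} (ab : Adj F a b) →
                      DeletesAtMost F (F ─ edge a b (Adj⇒≢ F ab)) a b
DeletesAtMost-─edge F {a} {b} ab = record
  { ⊆E-orig = ─-⊆E F e
  ; lost    = λ i j Fij ¬Fij′ → case Adj? e i j of λ where
      (yes eij) → edge-Adj⁻ a≢b eij
      (no ¬eij) → contradiction (─-Adj⁺ F e Fij ¬eij) ¬Fij′
  }
  where
  a≢b = Adj⇒≢ F ab
  e = edge a b a≢b

─-DeletesAtMost : (G : Graph n) {F F₀ : Graph n} {a b : Fin n} →
                  DeletesAtMost F F₀ a b → DeletesAtMost (G ─ F₀) (G ─ F) a b
─-DeletesAtMost G {F} {F₀} del = record
  { ⊆E-orig = ─-mono G F₀ F ⊆E-orig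
  ; lost    = λ i j e ¬e′ → case Adj? F i j of λ where
      (yes Fij) → lost i j Fij (─-Adj⁻ G F₀ e)
      (no ¬Fij) → contradiction (─-Adj⁺ G F (─-⊆E G F₀ i j e) ¬Fij) ¬e′
  }
  where open DeletesAtMost del

domNum-─ : (G F : Graph n) {g g′ : ℕ} → IsDomNum G g → IsDomNum (G ─ F) g′ → g′ ≤ g + edgeCount F
domNum-─ G F {g} γ = go (edgeCount F) F refl
  where
  go : ∀ c F {g′} → edgeCount F ≡ c → IsDomNum (G ─ F) g′ → g′ ≤ g + c
  go c F ecF γF with edge? F
  ... | no none = ≤-trans (≤-reflexive (domNum-unique (G ─ F) γF γ′)) (m≤m+n g c)
    where
    γ′ = domNum-cong G (G ─ F) (λ i j e → ─-Adj⁺ G F e λ f → none (i , j , f)) (─-⊆E G F) γ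
  ... | yes (a , b , ab) with c | trans (sym ecF) (edgeCount-OneEdgeMore (OneEdgeMore-─edge F ab))
  ...   | suc c | ecF₀ = begin
    _                ≤⟨ domNum-DeletesAtMost (─-DeletesAtMost G (DeletesAtMost-─edge F ab)) (proj₂ γ₀) γF ⟩
    suc (proj₁ γ₀)   ≤⟨ s≤s (go c F₀ (sym (suc-injective ecF₀)) (proj₂ γ₀)) ⟩
    suc (g + c)      ≡⟨ +-suc g c ⟨
    g + suc c        ∎
    where
    open ≤-Reasoning
    F₀ = F ─ edge a b (Adj⇒≢ F ab)
    γ₀ = domNum-exists (G ─ F₀)

-- Longest paths in forests

Linked-prefix : ∀ {A : Set} {R : A → A → Set} xs {y zs} → Linked R (xs ++ y ∷ zs) → Linked R (xs ++ y ∷ [])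
Linked-prefix []           _       = [-]
Linked-prefix (x ∷ [])     (r ∷ _) = r ∷ [-]
Linked-prefix (x ∷ x′ ∷ xs) (r ∷ l) = r ∷ Linked-prefix (x′ ∷ xs) l

AllPairs-prefix : ∀ {A : Set} {R : A → A → Set} xs {y zs} → AllPairs R (xs ++ y ∷ zs) → AllPairs R (xs ++ y ∷ [])
AllPairs-prefix []       (_ ∷ _)  = [] ∷ []
AllPairs-prefix (x ∷ xs) (px ∷ p) = ++⁺ (++⁻ˡ xs px) (All.head (++⁻ʳ xs px) ∷ []) ∷ AllPairs-prefix xs p

Unique⇒lookup-injective : {xs : List (Fin n)} → Unique xs → ∀ {i j} → lookup xs i ≡ lookup xs j → i ≡ j
Unique⇒lookup-injective (_ ∷ _)  {fzero}  {fzero}  _ = refl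
Unique⇒lookup-injective (px ∷ _) {fzero}  {fsuc j} e = contradiction e (All.lookup px (∈-lookup j))
Unique⇒lookup-injective (px ∷ _) {fsuc i} {fzero}  e = contradiction (sym e) (All.lookup px (∈-lookup i))
Unique⇒lookup-injective (_ ∷ u)  {fsuc i} {fsuc j} e = cong fsuc (Unique⇒lookup-injective u e)

Unique⇒length≤ : {xs : List (Fin n)} → Unique xs → length xs ≤ n
Unique⇒length≤ u = injective⇒≤ (Unique⇒lookup-injective u)

data EndConfiguration (H : Graph n) : Set where
  pendantPath : (u v w : Fin n) → Adj H u v → (∀ x → Adj H u x → x ≡ v) →
                (∀ x → Adj H v x → x ≡ u ⊎ x ≡ w) → EndConfiguration H
  cherry : (s l₁ l₂ : Fin n) → l₁ ≢ l₂ → Adj H s l₁ → Adj H s l₂ →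
           (∀ x → Adj H l₁ x → x ≡ s) → (∀ x → Adj H l₂ x → x ≡ s) → EndConfiguration H

module _ {n} (H : Graph n) (acyclicH : Acyclic H) where

  open import Data.List.Membership.DecPropositional (_≟ᶠ_ {n}) using () renaming (_∈?_ to _∈ₗ?_)

  record Path : Set where
    constructor path
    field
      {v₀ v₁} : Fin n
      {rest}  : List (Fin n)
      linked  : Linked (Adj H) (v₀ ∷ v₁ ∷ rest)
      unique  : Unique (v₀ ∷ v₁ ∷ rest)

    vertices : List (Fin n)
    vertices = v₀ ∷ v₁ ∷ rest

  open Path

  ¬Adj-start : ∀ {a b c rest} → Linked (Adj H) (a ∷ b ∷ rest) → Unique (a ∷ b ∷ rest) →
               c ∈ₗ rest → ¬ Adj H c a
  ¬Adj-start {a} {b} {c} l u c∈rest ca with ∈-∃++ c∈rest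
  ... | ys , zs , refl = acyclicH record
    { first    = a
    ; rest     = b ∷ ys
    ; last     = c
    ; long     = s≤s z≤n
    ; linked   = Linked-prefix (a ∷ b ∷ ys) l
    ; distinct = AllPairs-prefix (a ∷ b ∷ ys) u
    ; closes   = ca
    }

  ∉⇒All≢ : ∀ {x : Fin n} {ys} → x ∉ₗ ys → All (x ≢_) ys
  ∉⇒All≢ {ys = []}     _   = []
  ∉⇒All≢ {ys = y ∷ ys} x∉ = (x∉ ∘ here) ∷ ∉⇒All≢ (x∉ ∘ there)

  extendAt₀ : (p : Path) {y : Fin n} → Adj H y (v₀ p) → y ∉ₗ vertices p → Path
  extendAt₀ (path l u) yv₀ y∉ = path (yv₀ ∷ l) (∉⇒All≢ y∉ ∷ u)

  extendAt₁ : (p : Path) {x y : Fin n} → Adj H (v₁ p) x → x ∉ₗ vertices p → Adj H x y → y ∉ₗ vertices p → Path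
  extendAt₁ (path l u) v₁x x∉ xy y∉ =
    path (Adj-sym H xy ∷ Adj-sym H v₁x ∷ Linked.tail l)
         (((Adj⇒≢ H xy ∘ sym) ∷ ∉⇒All≢ (y∉ ∘ there)) ∷ ∉⇒All≢ (x∉ ∘ there) ∷ AllPairs.tail u)

  headOr : Fin n → List (Fin n) → Fin n
  headOr d []      = d
  headOr _ (x ∷ _) = x

  onPath⇒next : ∀ {v d x} rest → Linked (Adj H) (v ∷ rest) → Unique (v ∷ rest) →
                Adj H v x → x ∈ₗ rest → x ≡ headOr d rest
  onPath⇒next (_ ∷ _) _ _ _ (here x≡r) = x≡r
  onPath⇒next (_ ∷ _) l u vx (there x∈rest) = contradiction (Adj-sym H vx) (¬Adj-start l u x∈rest)

  startIsLeaf : (p : Path) → (∀ y → Adj H (v₀ p) y → y ∈ₗ vertices p) → ∀ y → Adj H (v₀ p) y → y ≡ v₁ p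
  startIsLeaf (path l u) closed₀ y v₀y with closed₀ y v₀y
  ... | here refl = contradiction v₀y (Adj-irrefl H)
  ... | there (here y≡v₁) = y≡v₁
  ... | there (there y∈rest) = contradiction (Adj-sym H v₀y) (¬Adj-start l u y∈rest)

  settle : (p : Path) → (∀ y → Adj H (v₀ p) y → y ∈ₗ vertices p) →
           (∀ x → Adj H (v₁ p) x → x ∉ₗ vertices p → ∀ y → Adj H x y → y ∈ₗ vertices p) →
           EndConfiguration H
  settle p@(path {v₀} {v₁} {rest} (v₀v₁ ∷ l₁) (_ ∷ u₁)) closed₀ closed₁
    with any? (λ x → Adj? H v₁ x ×-dec ¬? (x ∈ₗ? v₀ ∷ v₁ ∷ rest))
  ... | yes (x , v₁x , x∉) = cherry v₁ v₀ x (x∉ ∘ here ∘ sym) (Adj-sym H v₀v₁) v₁x (startIsLeaf p closed₀) leafₓ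
    where
    leafₓ : ∀ y → Adj H x y → y ≡ v₁
    leafₓ y xy with closed₁ x v₁x x∉ y xy
    ... | here refl = contradiction (Adj-sym H xy)
                        (¬Adj-start (Adj-sym H v₁x ∷ Adj-sym H v₀v₁ ∷ [-])
                                    (((x∉ ∘ there ∘ here) ∷ (x∉ ∘ here) ∷ []) ∷ (Adj⇒≢ H (Adj-sym H v₀v₁) ∷ []) ∷ [] ∷ [])
                                    (here refl))
    ... | there (here y≡v₁) = y≡v₁
    ... | there (there y∈rest) =
      contradiction (Adj-sym H xy) (¬Adj-start (Adj-sym H v₁x ∷ l₁) (∉⇒All≢ (x∉ ∘ there) ∷ u₁) y∈rest)
  ... | no ¬leaf = pendantPath v₀ v₁ (headOr v₀ rest) v₀v₁ (startIsLeaf p closed₀) nbrs₁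
    where
    nbrs₁ : ∀ x → Adj H v₁ x → x ≡ v₀ ⊎ x ≡ headOr v₀ rest
    nbrs₁ x v₁x with x ∈ₗ? v₀ ∷ v₁ ∷ rest
    ... | no x∉ = contradiction (x , v₁x , x∉) ¬leaf
    ... | yes (here x≡v₀) = inj₁ x≡v₀
    ... | yes (there (here refl)) = contradiction v₁x (Adj-irrefl H)
    ... | yes (there (there x∈rest)) = inj₂ (onPath⇒next rest l₁ u₁ v₁x x∈rest)

  -- Grow the path at its start (possibly rerouting past v₀) until stuck; a path has at most n vertices,
  -- so fuel n suffices.
  private
    mutual
      grow : ∀ fuel (p : Path) → n ≤ length (vertices p) + fuel → EndConfiguration H
      grow fuel p bound with any? (λ y → Adj? H (v₀ p) y ×-dec ¬? (y ∈ₗ? vertices p))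
      ... | yes (y , v₀y , y∉) = continue fuel p (extendAt₀ p (Adj-sym H v₀y) y∉) refl bound
      ... | no stuck₀ with any? (λ x → Adj? H (v₁ p) x ×-dec ¬? (x ∈ₗ? vertices p) ×-dec
                                         any? (λ y → Adj? H x y ×-dec ¬? (y ∈ₗ? vertices p)))
      ...   | yes (x , v₁x , x∉ , y , xy , y∉) = continue fuel p (extendAt₁ p v₁x x∉ xy y∉) refl bound
      ...   | no stuck₁ = settle p
          (λ y v₀y → decidable-stable (y ∈ₗ? vertices p) λ y∉ → stuck₀ (y , v₀y , y∉))
          (λ x v₁x x∉ y xy → decidable-stable (y ∈ₗ? vertices p) λ y∉ → stuck₁ (x , v₁x , x∉ , y , xy , y∉))

      continue : ∀ fuel (p q : Path) → length (vertices q) ≡ suc (length (vertices p)) →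
                 n ≤ length (vertices p) + fuel → EndConfiguration H
      continue zero p q q≡1+p bound =
        contradiction (Unique⇒length≤ (unique q))
                      (<⇒≱ (subst (n <_) (sym q≡1+p) (s≤s (subst (n ≤_) (+-identityʳ _) bound))))
      continue (suc fuel) p q q≡1+p bound =
        grow fuel q (subst (λ m → n ≤ m + fuel) (sym q≡1+p) (subst (n ≤_) (+-suc _ fuel) bound))

  endConfiguration : ∀ {a b} → Adj H a b → EndConfiguration H
  endConfiguration ab = grow n (path (ab ∷ [-]) ((Adj⇒≢ H ab ∷ []) ∷ [] ∷ [])) (m≤n+m n 2)

-- Upper bound

isolated∈ : (G : Graph n) {D : Subset n} {u : Fin n} → Dominating G D → (∀ x → ¬ Adj G u x) → u ∈ D
isolated∈ G dom iso with dom _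
... | inj₁ u∈D = u∈D
... | inj₂ (x , _ , xu) = contradiction (Adj-sym G xu) (iso x)

Dominating-dropIsolated : (H₂ H : Graph n) → H₂ ⊆E H → {D : Subset n} {u v : Fin n} → Dominating H₂ D →
                          (∀ x → ¬ Adj H₂ u x) → v ∈ D → Adj H v u → Dominating H (D - u)
Dominating-dropIsolated H₂ H H₂⊆H {D} {u} {v} dom iso v∈D vu w with w ≟ᶠ u
... | yes refl = inj₂ (v , x∈p∧x≢y⇒x∈p-y v∈D (Adj⇒≢ H vu) , vu)
... | no w≢u with dom w
...   | inj₁ w∈D = inj₁ (x∈p∧x≢y⇒x∈p-y w∈D w≢u)
...   | inj₂ (x , x∈D , xw) = inj₂ (x , x∈p∧x≢y⇒x∈p-y x∈D (λ { refl → iso w xw }) , H₂⊆H x w xw)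

domNum<∣D∣ : (H₂ H : Graph n) → H₂ ⊆E H → {D : Subset n} {u v : Fin n} → Dominating H₂ D →
             (∀ x → ¬ Adj H₂ u x) → v ∈ D → Adj H v u → ∀ {h} → IsDomNum H h → h < ∣ D ∣
domNum<∣D∣ H₂ H H₂⊆H dom iso v∈D vu (_ , min) =
  ≤-<-trans (min _ (Dominating-dropIsolated H₂ H H₂⊆H dom iso v∈D vu)) (x∈p⇒∣p-x∣<∣p∣ (isolated∈ H₂ dom iso))

Dominating-swapLeaf : (G : Graph n) {D : Subset n} {l s : Fin n} → Dominating G D →
                      (∀ x → Adj G l x → x ≡ s) → Adj G s l → Dominating G ((D - l) ∪ ⁅ s ⁆)
Dominating-swapLeaf G {D} {l} {s} dom leaf sl w with w ≟ᶠ l | w ≟ᶠ s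
... | yes refl | _        = inj₂ (s , x∈p∪q⁺ (inj₂ (x∈⁅x⁆ s)) , sl)
... | no _     | yes refl = inj₁ (x∈p∪q⁺ (inj₂ (x∈⁅x⁆ s)))
... | no w≢l   | no w≢s with dom w
...   | inj₁ w∈D = inj₁ (x∈p∪q⁺ (inj₁ (x∈p∧x≢y⇒x∈p-y w∈D w≢l)))
...   | inj₂ (x , x∈D , xw) = inj₂ (x , x∈p∪q⁺ (inj₁ (x∈p∧x≢y⇒x∈p-y x∈D λ { refl → w≢s (leaf w xw) })) , xw)

dominatingWithSupport : (G : Graph n) {D : Subset n} {l s : Fin n} → Dominating G D →
                        (∀ x → Adj G l x → x ≡ s) → Adj G s l →
                        ∃ λ D′ → Dominating G D′ × s ∈ D′ × ∣ D′ ∣ ≤ ∣ D ∣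
dominatingWithSupport G {D} {l} {s} dom leaf sl with s ∈? D
... | yes s∈D = D , dom , s∈D , ≤-refl
... | no s∉D = (D - l) ∪ ⁅ s ⁆ , Dominating-swapLeaf G dom leaf sl , x∈p∪q⁺ (inj₂ (x∈⁅x⁆ s)) ,
               ≤-trans (∣p∪⁅x⁆∣≤1+∣p∣ (D - l) s) (x∈p⇒∣p-x∣<∣p∣ l∈D)
  where
  l∈D : l ∈ D
  l∈D with dom l
  ... | inj₁ l∈D = l∈D
  ... | inj₂ (x , x∈D , xl) with refl ← leaf x (Adj-sym G xl) = contradiction x∈D s∉D

record Deletion (T F : Graph n) (a b : Fin n) : Set where
  field
    F′      : Graph n
    F′⊆T    : F′ ⊆E T
    count   : edgeCount F′ ≤ suc (edgeCount F)
    deletes : DeletesAtMost (T ─ F) (T ─ F′) a b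
    gone    : ¬ Adj (T ─ F′) a b

  shrinks : (T ─ F′) ⊆E (T ─ F)
  shrinks = DeletesAtMost.⊆E-orig deletes

deleteEdge : (T F : Graph n) → F ⊆E T → (a b : Fin n) → Deletion T F a b
deleteEdge T F F⊆T a b with Adj? (T ─ F) a b
... | no ¬ab = record
  { F′ = F ; F′⊆T = F⊆T ; count = n≤1+n _ ; gone = ¬ab
  ; deletes = record { ⊆E-orig = λ _ _ e → e ; lost = λ i j e ¬e → contradiction e ¬e }
  }
... | yes ab = record
  { F′      = F ∪E e
  ; F′⊆T    = F′⊆T
  ; count   = ≤-reflexive (edgeCount-OneEdgeMore more)
  ; deletes = ─-DeletesAtMost T record
      { ⊆E-orig = ∪E-⊆ˡ F e
      ; lost    = λ i j e∪ ¬Fij → case ∪E-Adj⁻ F e e∪ of λ where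
          (inj₁ Fij) → contradiction Fij ¬Fij
          (inj₂ eij) → edge-Adj⁻ a≢b eij
      }
  ; gone    = λ ab′ → ─-Adj⁻ T (F ∪E e) ab′ (OneEdgeMore.new more)
  }
  where
  a≢b = Adj⇒≢ (T ─ F) ab
  e = edge a b a≢b
  more = OneEdgeMore-∪edge F a≢b (─-Adj⁻ T F ab)
  F′⊆T : (F ∪E e) ⊆E T
  F′⊆T i j Fij with ∪E-Adj⁻ F e Fij
  ... | inj₁ Fij = F⊆T i j Fij
  ... | inj₂ eij with edge-Adj⁻ a≢b {i} {j} eij
  ...   | inj₁ (refl , refl) = ─-⊆E T F a b ab
  ...   | inj₂ (refl , refl) = Adj-sym T (─-⊆E T F a b ab)

domNum-cherry : (H₁ H : Graph n) → H₁ ⊆E H → {s l₁ l₂ : Fin n} → (∀ x → ¬ Adj H₁ l₁ x) → Adj H s l₁ →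
                Adj H₁ s l₂ → (∀ x → Adj H₁ l₂ x → x ≡ s) → ∀ {h g₁} → IsDomNum H h → IsDomNum H₁ g₁ → h < g₁
domNum-cherry H₁ H H₁⊆H iso₁ sl₁ sl₂ leaf₂ γ ((D , dom , refl) , _)
  with D′ , dom′ , s∈D′ , ∣D′∣≤∣D∣ ← dominatingWithSupport H₁ dom leaf₂ sl₂ =
  <-≤-trans (domNum<∣D∣ H₁ H H₁⊆H dom′ iso₁ s∈D′ sl₁ γ) ∣D′∣≤∣D∣

domNum-pendant : (H₂ H : Graph n) → H₂ ⊆E H → {u v : Fin n} → (∀ x → ¬ Adj H₂ u x) → (∀ x → ¬ Adj H₂ v x) →
                 Adj H v u → ∀ {h g₂} → IsDomNum H h → IsDomNum H₂ g₂ → h < g₂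
domNum-pendant H₂ H H₂⊆H isoᵤ isoᵥ vu γ ((D , dom , refl) , _) =
  domNum<∣D∣ H₂ H H₂⊆H dom isoᵤ (isolated∈ H₂ dom isoᵥ) vu γ

Reaches : (T F : Graph n) (g c : ℕ) → Set
Reaches {n} T F g c = ∃ λ F′ → F′ ⊆E T × IsDomNum (T ─ F′) g × edgeCount F′ ≤ c + edgeCount F

module _ (T F : Graph n) (F⊆T : F ⊆E T) {h : ℕ} (γ : IsDomNum (T ─ F) h) where

  private
    H = T ─ F

  raiseAtCherry : ∀ {s l₁ l₂} → l₁ ≢ l₂ → Adj H s l₁ → Adj H s l₂ →
                  (∀ x → Adj H l₁ x → x ≡ s) → (∀ x → Adj H l₂ x → x ≡ s) → Reaches T F (suc h) 2
  raiseAtCherry {s} {l₁} {l₂} l₁≢l₂ sl₁ sl₂ leaf₁ leaf₂ =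
    F′ , F′⊆T , subst (IsDomNum H₁) g₁≡1+h γ₁ , ≤-trans count (n≤1+n _)
    where
    open Deletion (deleteEdge T F F⊆T s l₁)
    H₁ = T ─ F′
    γ₁ = proj₂ (domNum-exists H₁)
    iso₁ : ∀ x → ¬ Adj H₁ l₁ x
    iso₁ x l₁x with refl ← leaf₁ x (shrinks l₁ x l₁x) = gone (Adj-sym H₁ l₁x)
    sl₂′ : Adj H₁ s l₂
    sl₂′ with Adj? H₁ s l₂
    ... | yes sl₂′ = sl₂′
    ... | no ¬sl₂′ with DeletesAtMost.lost deletes s l₂ sl₂ ¬sl₂′
    ...   | inj₁ (_ , l₂≡l₁) = contradiction (sym l₂≡l₁) l₁≢l₂
    ...   | inj₂ (s≡l₁ , _) = contradiction s≡l₁ (Adj⇒≢ H sl₁)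
    g₁≡1+h : proj₁ (domNum-exists H₁) ≡ suc h
    g₁≡1+h = ≤-antisym (domNum-DeletesAtMost deletes γ γ₁)
                       (domNum-cherry H₁ H shrinks iso₁ sl₁ sl₂′ (λ x → leaf₂ x ∘ shrinks l₂ x) γ γ₁)

  -- If deleting uv leaves γ unchanged, deleting vw as well isolates both u and v.
  raiseAtPendant : ∀ {u v w} → Adj H u v → (∀ x → Adj H u x → x ≡ v) →
                   (∀ x → Adj H v x → x ≡ u ⊎ x ≡ w) → Reaches T F (suc h) 2
  raiseAtPendant {u} {v} {w} uv leafᵤ nbrsᵥ = deleteSecondIfNeeded (domNum-exists H₁)
    where
    open Deletion (deleteEdge T F F⊆T u v)
    H₁ = T ─ F′
    deleteSecondIfNeeded : ∃ (IsDomNum H₁) → Reaches T F (suc h) 2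
    deleteSecondIfNeeded (g₁ , γ₁) with g₁ ≟ suc h
    ... | yes refl = F′ , F′⊆T , γ₁ , ≤-trans count (n≤1+n _)
    ... | no g₁≢1+h = F₂ , F₂⊆T , subst (IsDomNum H₂) g₂≡1+h γ₂ , ≤-trans count₂ (s≤s count)
      where
      open Deletion (deleteEdge T F′ F′⊆T v w)
        renaming (F′ to F₂; F′⊆T to F₂⊆T; count to count₂; deletes to deletes₂; gone to gone₂; shrinks to shrinks₂)
      H₂ = T ─ F₂
      γ₂ = proj₂ (domNum-exists H₂)
      g₁≡h : g₁ ≡ h
      g₁≡h = ≤-antisym (≤-pred (≤∧≢⇒< (domNum-DeletesAtMost deletes γ γ₁) g₁≢1+h)) (domNum-mono H₁ H shrinks γ₁ γ)
      isoᵤ : ∀ x → ¬ Adj H₂ u x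
      isoᵤ x ux with refl ← leafᵤ x (shrinks u x (shrinks₂ u x ux)) = gone (shrinks₂ u v ux)
      isoᵥ : ∀ x → ¬ Adj H₂ v x
      isoᵥ x vx with nbrsᵥ x (shrinks v x (shrinks₂ v x vx))
      ... | inj₁ refl = gone (shrinks₂ u v (Adj-sym H₂ vx))
      ... | inj₂ refl = gone₂ vx
      g₂≡1+h : proj₁ (domNum-exists H₂) ≡ suc h
      g₂≡1+h = ≤-antisym (subst (λ g → proj₁ (domNum-exists H₂) ≤ suc g) g₁≡h (domNum-DeletesAtMost deletes₂ γ₁ γ₂))
                         (domNum-pendant H₂ H (λ i j → shrinks i j ∘ shrinks₂ i j) isoᵤ isoᵥ (Adj-sym H uv) γ γ₂)

Acyclic-⊆E : (H G : Graph n) → H ⊆E G → Acyclic G → Acyclic H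
Acyclic-⊆E H G H⊆G acyclicG c = acyclicG record
  { first = first ; rest = rest ; last = last ; long = long
  ; linked = Linked.map (H⊆G _ _) linked ; distinct = distinct ; closes = H⊆G _ _ closes }
  where open Cycle c

raiseByOne : (T : Graph n) → Acyclic T → (F : Graph n) → F ⊆E T → ∀ {h} → IsDomNum (T ─ F) h → h < n →
             Reaches T F (suc h) 2
raiseByOne T acyclicT F F⊆T γ h<n with edge? (T ─ F)
... | no none = contradiction (domNum-unique (T ─ F) γ (domNum-edgeless (T ─ F) λ i j e → none (i , j , e))) (<⇒≢ h<n)
... | yes (_ , _ , ab) with endConfiguration (T ─ F) (Acyclic-⊆E (T ─ F) T (─-⊆E T F) acyclicT) ab
...   | pendantPath _ _ _ uv leafᵤ nbrsᵥ = raiseAtPendant T F F⊆T γ uv leafᵤ nbrsᵥ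
...   | cherry _ _ _ l₁≢l₂ sl₁ sl₂ leaf₁ leaf₂ = raiseAtCherry T F F⊆T γ l₁≢l₂ sl₁ sl₂ leaf₁ leaf₂

raiseBy : (T : Graph n) → Acyclic T → ∀ d (F : Graph n) → F ⊆E T → ∀ {h} → IsDomNum (T ─ F) h → h + d ≤ n →
          Reaches T F (h + d) (2 * d)
raiseBy T acyclicT zero F F⊆T {h} γ _ = F , F⊆T , subst (IsDomNum (T ─ F)) (sym (+-identityʳ h)) γ , ≤-refl
raiseBy {n} T acyclicT (suc d) F F⊆T {h} γ h+1+d≤n
  with F₁ , F₁⊆T , γ₁ , count₁ ← raiseByOne T acyclicT F F⊆T γ (<-≤-trans (m<m+n h (s≤s z≤n)) h+1+d≤n)
  with F₂ , F₂⊆T , γ₂ , count₂ ← raiseBy T acyclicT d F₁ F₁⊆T γ₁ (subst (_≤ n) (+-suc h d) h+1+d≤n) =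
  F₂ , F₂⊆T , subst (IsDomNum (T ─ F₂)) (sym (+-suc h d)) γ₂ ,
  ≤-trans count₂ (subst (2 * d + edgeCount F₁ ≤_) (twice-suc d (edgeCount F)) (+-monoʳ-≤ (2 * d) count₁))
  where
  twice-suc : ∀ d c → 2 * d + (2 + c) ≡ 2 * suc d + c
  twice-suc = solve 2 (λ d c → con 2 :* d :+ (con 2 :+ c) := con 2 :* (con 1 :+ d) :+ c) refl
    where open +-*-Solver

Searchable : Set → Set₁
Searchable A = ∀ {P : A → Set} → Decidable P → Dec (∃ P)

searchable-Vec : {A : Set} → Searchable A → ∀ m → Searchable (Vec A m)
searchable-Vec any? zero {P} P? with P? []
... | yes p = yes ([] , p)
... | no ¬p = no λ { ([] , p) → ¬p p }
searchable-Vec any? (suc m) {P} P? with any? (λ x → searchable-Vec any? m (P? ∘ (x ∷_)))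
... | yes (x , xs , p) = yes (x ∷ xs , p)
... | no ¬p = no λ { (x ∷ xs , p) → ¬p (x , xs , p) }

-- Edge sets are enumerated as n × n Boolean matrices, so minimising over them is a finite search.
EdgeMatrix : ℕ → Set
EdgeMatrix n = Vec (Subset n) n

_[_,_] : EdgeMatrix n → Fin n → Fin n → Bool
M [ i , j ] = Vec.lookup (Vec.lookup M i) j

selectEdges : Graph n → EdgeMatrix n → Graph n
adj (selectEdges G M) i j = adj G i j ∧ (M [ i , j ] ∨ M [ j , i ])
Graph.sym (selectEdges G M) i j rewrite Graph.sym G i j | ∨-comm (M [ i , j ]) (M [ j , i ]) = refl
irrefl (selectEdges G M) i rewrite irrefl G i = refl

selectEdges-⊆E : (G : Graph n) (M : EdgeMatrix n) → selectEdges G M ⊆E G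
selectEdges-⊆E G M i j = ∧-conicalˡ _ _

toMatrix : Graph n → EdgeMatrix n
toMatrix F = Vec.tabulate λ i → Vec.tabulate (adj F i)

selectEdges-toMatrix : (G F : Graph n) → F ⊆E G → ∀ i j → adj (selectEdges G (toMatrix F)) i j ≡ adj F i j
selectEdges-toMatrix G F F⊆G i j
  rewrite lookup∘tabulate (λ i → Vec.tabulate (adj F i)) i | lookup∘tabulate (adj F i) j
        | lookup∘tabulate (λ i → Vec.tabulate (adj F i)) j | lookup∘tabulate (adj F j) i
        | Graph.sym F j i
  with adj F i j in Fij
... | true  rewrite F⊆G i j Fij = refl
... | false = ∧-zeroʳ _

RaisesBy-cong : (G F F′ : Graph n) → (∀ i j → adj F i j ≡ adj F′ i j) → ∀ {k} → RaisesBy G F k → RaisesBy G F′ k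
RaisesBy-cong G F F′ F≗F′ raises g γ =
  domNum-cong (G ─ F) (G ─ F′) (─-cong F F′ F≗F′) (─-cong F′ F (λ i j → sym (F≗F′ i j))) (raises g γ)
  where
  ─-cong : (F F′ : Graph _) → (∀ i j → adj F i j ≡ adj F′ i j) → (G ─ F) ⊆E (G ─ F′)
  ─-cong F F′ F≗F′ i j = subst (λ x → (adj G i j ∧ not x) ≡ true) (F≗F′ i j)

raisesBy? : (G F : Graph n) → ∀ k → Dec (RaisesBy G F k)
raisesBy? G F k with domNum-exists G | domNum-exists (G ─ F)
... | g , γ | g′ , γ′ with g′ ≟ g + k
...   | yes refl = yes λ _ γ″ → subst (λ g → IsDomNum (G ─ F) (g + k)) (domNum-unique G γ γ″) γ′
...   | no g′≢g+k = no λ raises → g′≢g+k (domNum-unique (G ─ F) γ′ (raises g γ))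

module _ (k : ℕ) (G : Graph n) where

  SelectedBy : ℕ → Set
  SelectedBy c = ∃ λ M → RaisesBy G (selectEdges G M) k × edgeCount (selectEdges G M) ≡ c

  selectedBy? : Decidable SelectedBy
  selectedBy? c = searchable-Vec anySubset? n λ M →
    raisesBy? G (selectEdges G M) k ×-dec edgeCount (selectEdges G M) ≟ c

  selected : ∀ F → F ⊆E G → RaisesBy G F k → SelectedBy (edgeCount F)
  selected F F⊆G raises =
    toMatrix F ,
    RaisesBy-cong G F (selectEdges G (toMatrix F)) (λ i j → sym (selectEdges-toMatrix G F F⊆G i j)) raises ,
    edgeCount-cong (selectEdges G (toMatrix F)) F (selectEdges-toMatrix G F F⊆G)

  Sb-exists : ∀ F → F ⊆E G → RaisesBy G F k → ∃ λ m → IsSb k G m × m ≤ edgeCount F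
  Sb-exists F F⊆G raises with least selectedBy? (selected F F⊆G raises)
  ... | m , (M , raisesₘ , refl) , min =
    m , ((selectEdges G M , selectEdges-⊆E G M , raisesₘ , refl) , λ F′ F′⊆G r′ → min (selected F′ F′⊆G r′)) ,
    min (selected F F⊆G raises)

RaisesBy-intro : (G F : Graph n) {g k : ℕ} → IsDomNum G g → IsDomNum (G ─ F) (g + k) → RaisesBy G F k
RaisesBy-intro G F {k = k} γ γ′ g γ″ = subst (λ g → IsDomNum (G ─ F) (g + k)) (domNum-unique G γ γ″) γ′

RaisesBy⇒≤edgeCount : (G F : Graph n) {g k : ℕ} → IsDomNum G g → RaisesBy G F k → k ≤ edgeCount F
RaisesBy⇒≤edgeCount G F {g} {k} γ raises = +-cancelˡ-≤ g k (edgeCount F) (domNum-─ G F γ (raises g γ))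

noEdges : Graph n
adj noEdges _ _ = false
Graph.sym noEdges _ _ = refl
irrefl noEdges _ = refl

domNum-─noEdges : (G : Graph n) {g : ℕ} → IsDomNum G g → IsDomNum (G ─ noEdges) g
domNum-─noEdges G = domNum-cong G (G ─ noEdges) (λ i j e → trans (∧-identityʳ _) e) (λ i j e → trans (sym (∧-identityʳ _)) e)

Sb-bounds : ∀ k (T : Graph n) → Hyp k T → ∃ λ m → IsSb k T m × k ≤ m × m ≤ 2 * k
Sb-bounds {n} k T ((_ , _ , acyclicT) , _ , room) with g , γ ← domNum-exists T
  with F , F⊆T , γF , countF ← raiseBy T acyclicT k noEdges (λ _ _ ()) (domNum-─noEdges T γ) (room g γ)
  with m , sb@((F₀ , _ , raises₀ , refl) , _) , m≤F ← Sb-exists k T F F⊆T (RaisesBy-intro T F γ γF) =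
  m , sb , RaisesBy⇒≤edgeCount T F₀ γ raises₀ ,
  ≤-trans m≤F (≤-trans countF (≤-reflexive (trans (cong (2 * k +_) (edgeCount-edgeless (noEdges {n}) λ _ _ ())) (+-identityʳ _))))

IsSb-≥ : ∀ {k} {G : Graph n} {m c} → IsSb k G m → (∀ F → F ⊆E G → RaisesBy G F k → c ≤ edgeCount F) → c ≤ m
IsSb-≥ ((F , F⊆G , raises , refl) , _) lower = lower F F⊆G raises

-- Trees given by a parent function

NonBacktracking : List (Fin n) → Set
NonBacktracking (x ∷ y ∷ z ∷ zs) = x ≢ z × NonBacktracking (y ∷ z ∷ zs)
NonBacktracking _ = ⊤′

LastStepDown : List (Fin n) → Set
LastStepDown (x ∷ y ∷ [])     = y <ᶠ x
LastStepDown (_ ∷ y ∷ z ∷ zs) = LastStepDown (y ∷ z ∷ zs)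
LastStepDown _                = ⊥

NonBacktracking-snoc : ∀ (xs : List (Fin n)) {z} → Unique xs → All (_≢ z) xs → NonBacktracking (xs ++ z ∷ [])
NonBacktracking-snoc []               _                     _              = tt
NonBacktracking-snoc (_ ∷ [])         _                     _              = tt
NonBacktracking-snoc (_ ∷ _ ∷ [])     _                     (x≢z ∷ _)      = x≢z , tt
NonBacktracking-snoc (_ ∷ y ∷ w ∷ xs) ((_ ∷ x≢w ∷ _) ∷ u) (_ ∷ ≢z)    = x≢w , NonBacktracking-snoc (y ∷ w ∷ xs) u ≢z

NonBacktracking-closed : ∀ {a b : Fin n} ys {l} → Unique (a ∷ b ∷ ys ++ l ∷ []) →
                         NonBacktracking ((a ∷ b ∷ ys ++ l ∷ []) ++ a ∷ [])
NonBacktracking-closed []      (a≢@(_ ∷ a≢l ∷ _) ∷ u) = a≢l , NonBacktracking-snoc _ u (All.map (_∘ sym) a≢)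
NonBacktracking-closed (_ ∷ _) (a≢@(_ ∷ a≢y ∷ _) ∷ u) = a≢y , NonBacktracking-snoc _ u (All.map (_∘ sym) a≢)

LastStepDown-snoc : ∀ (xs : List (Fin n)) {y z} → z <ᶠ y → LastStepDown ((xs ++ y ∷ []) ++ z ∷ [])
LastStepDown-snoc []                z<y = z<y
LastStepDown-snoc (_ ∷ [])          z<y = z<y
LastStepDown-snoc (_ ∷ _ ∷ [])      z<y = z<y
LastStepDown-snoc (_ ∷ x ∷ x′ ∷ xs) z<y = LastStepDown-snoc (x ∷ x′ ∷ xs) z<y

Linked-snoc : ∀ {R : Fin n → Fin n → Set} xs {y z} → Linked R (xs ++ y ∷ []) → R y z → Linked R ((xs ++ y ∷ []) ++ z ∷ [])
Linked-snoc []            _       r = r ∷ [-]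
Linked-snoc (_ ∷ [])      (r ∷ _) s = r ∷ s ∷ [-]
Linked-snoc (_ ∷ x′ ∷ xs) (r ∷ l) s = r ∷ Linked-snoc (x′ ∷ xs) l s

¬Linked-closed : ∀ {R : Fin n → Fin n → Set} → (∀ {x y z} → R x y → R y z → R x z) → (∀ {x} → ¬ R x x) →
                 ∀ {a} xs → ¬ Linked R (a ∷ xs ++ a ∷ [])
¬Linked-closed R-trans R-irrefl []       (r ∷ _) = R-irrefl r
¬Linked-closed R-trans R-irrefl (_ ∷ xs) (r ∷ l) = R-irrefl (All.head (++⁻ʳ xs (All.tail (Linked⇒All R-trans r l))))

module _ (G : Graph n) (lowerNeighbour-unique : ∀ {j x y} → Adj G x j → Adj G y j → x <ᶠ j → y <ᶠ j → x ≡ y) where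

  -- A walk without backtracking that goes up once keeps going up: a peak would have two smaller neighbours.
  private
    noPeak : ∀ {x y z} → Adj G x y → Adj G y z → x ≢ z → x <ᶠ y → y <ᶠ z
    noPeak {y = y} {z} xy yz x≢z x<y with <ᶠ-cmp y z
    ... | tri< y<z _ _ = y<z
    ... | tri≈ _ refl _ = contradiction yz (Adj-irrefl G)
    ... | tri> _ _ z<y = contradiction (lowerNeighbour-unique xy (Adj-sym G yz) x<y z<y) x≢z

    ascending : ∀ {x y zs} → Linked (Adj G) (x ∷ y ∷ zs) → NonBacktracking (x ∷ y ∷ zs) → x <ᶠ y →
                Linked _<ᶠ_ (x ∷ y ∷ zs)
    ascending {zs = []}    _        _          x<y = x<y ∷ [-]
    ascending {zs = _ ∷ _} (xy ∷ l) (x≢z , nb) x<y = x<y ∷ ascending l nb (noPeak xy (Linked.head l) x≢z x<y)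

    descending : ∀ {x y zs} → Linked (Adj G) (x ∷ y ∷ zs) → NonBacktracking (x ∷ y ∷ zs) →
                 LastStepDown (x ∷ y ∷ zs) → Linked (flip _<ᶠ_) (x ∷ y ∷ zs)
    descending {zs = []} _ _ y<x = y<x ∷ [-]
    descending {x} {y} {zs = _ ∷ _} (xy ∷ l) (x≢z , nb) down with descending l nb down
    ... | below@(z<y ∷ _) with <ᶠ-cmp x y
    ...   | tri< x<y _ _ = contradiction z<y (<-asym (noPeak xy (Linked.head l) x≢z x<y))
    ...   | tri≈ _ refl _ = contradiction xy (Adj-irrefl G)
    ...   | tri> _ _ y<x = y<x ∷ below

  -- Close a cycle a b … l to the walk a b … l a. If a < b it ascends back to a, if a < l it descends back
  -- to a, and otherwise b and l are two smaller neighbours of a.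
  lowerNeighbour-unique⇒Acyclic : Acyclic G
  lowerNeighbour-unique⇒Acyclic record { rest = [] ; long = () }
  lowerNeighbour-unique⇒Acyclic record { first = a ; rest = b ∷ ys ; last = l ; linked = linked ; distinct = distinct ; closes = la }
    with <ᶠ-cmp a b | <ᶠ-cmp a l
  ... | tri< a<b _ _  | _ = ¬Linked-closed <-trans (<-irrefl refl) (b ∷ ys ++ l ∷ [])
    (ascending (Linked-snoc (a ∷ b ∷ ys) linked la) (NonBacktracking-closed ys distinct) a<b)
  ... | tri≈ _ refl _ | _ = contradiction (Linked.head linked) (Adj-irrefl G)
  ... | _ | tri< a<l _ _ = ¬Linked-closed (flip <-trans) (<-irrefl refl) (b ∷ ys ++ l ∷ [])
    (descending (Linked-snoc (a ∷ b ∷ ys) linked la) (NonBacktracking-closed ys distinct) (LastStepDown-snoc (a ∷ b ∷ ys) a<l))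
  ... | _ | tri≈ _ refl _ = contradiction la (Adj-irrefl G)
  ... | tri> _ _ b<a | tri> _ _ l<a =
    All.lookup (AllPairs.head (AllPairs.tail distinct)) (∈-++⁺ʳ ys (here refl))
               (lowerNeighbour-unique (Adj-sym G (Linked.head linked)) la b<a l<a)

_++ᵂ_ : {G : Graph n} {u v w : Fin n} → Walk G u v → Walk G v w → Walk G u w
[]      ++ᵂ q = q
(e ∷ p) ++ᵂ q = e ∷ (p ++ᵂ q)

reverseᵂ : {G : Graph n} {u v : Fin n} → Walk G u v → Walk G v u
reverseᵂ         []      = []
reverseᵂ {G = G} (e ∷ p) = reverseᵂ p ++ᵂ (Adj-sym G e ∷ [])

module ParentGraph (m : ℕ) (parent : ℕ → ℕ) (parent< : ∀ {b} → 0 < b → parent b < b) where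

  ParentOf : Fin (suc m) → Fin (suc m) → Set
  ParentOf i j = 0 < toℕ j × toℕ i ≡ parent (toℕ j)

  parentOf? : ∀ i j → Dec (ParentOf i j)
  parentOf? i j = 0 <? toℕ j ×-dec toℕ i ≟ parent (toℕ j)

  ParentOf⇒< : ∀ {i j} → ParentOf i j → toℕ i < toℕ j
  ParentOf⇒< (0<j , i≡) = subst (_< _) (sym i≡) (parent< 0<j)

  parentGraph : Graph (suc m)
  adj parentGraph i j = does (parentOf? i j ⊎-dec parentOf? j i)
  Graph.sym parentGraph i j = does-⇔ (mk⇔ swap swap) (parentOf? i j ⊎-dec parentOf? j i) (parentOf? j i ⊎-dec parentOf? i j)
  irrefl parentGraph i = dec-false (parentOf? i i ⊎-dec parentOf? i i) λ p → <-irrefl refl ([ ParentOf⇒< , ParentOf⇒< ]′ p)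

  Adj⇒ParentOf : ∀ {i j} → Adj parentGraph i j → ParentOf i j ⊎ ParentOf j i
  Adj⇒ParentOf {i} {j} = does≡true⇒ (parentOf? i j ⊎-dec parentOf? j i)

  ParentOf⇒Adj : ∀ {i j} → ParentOf i j → Adj parentGraph i j
  ParentOf⇒Adj {i} {j} p = dec-true (parentOf? i j ⊎-dec parentOf? j i) (inj₁ p)

  smallerNeighbour : ∀ {x j} → Adj parentGraph x j → toℕ x < toℕ j → toℕ x ≡ parent (toℕ j)
  smallerNeighbour xj x<j with Adj⇒ParentOf xj
  ... | inj₁ (_ , x≡) = x≡
  ... | inj₂ p = contradiction x<j (<-asym (ParentOf⇒< p))

  parentGraph-acyclic : Acyclic parentGraph
  parentGraph-acyclic = lowerNeighbour-unique⇒Acyclic parentGraph λ xj yj x<j y<j →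
    toℕ-injective (trans (smallerNeighbour xj x<j) (sym (smallerNeighbour yj y<j)))

  parentVertex : (j : Fin (suc m)) → 0 < toℕ j → Fin (suc m)
  parentVertex j 0<j = fromℕ< (<-trans (parent< 0<j) (toℕ<n j))

  ParentOf-parentVertex : ∀ j (0<j : 0 < toℕ j) → ParentOf (parentVertex j 0<j) j
  ParentOf-parentVertex j 0<j = 0<j , toℕ-fromℕ< _

  private
    walkToRoot : ∀ f (v : Fin (suc m)) → toℕ v < f → Walk parentGraph v fzero
    walkToRoot _       fzero      _   = []
    walkToRoot (suc f) v@(fsuc _) v<f =
      Adj-sym parentGraph {parentVertex v z<s} {v} (ParentOf⇒Adj (ParentOf-parentVertex v z<s)) ∷
      walkToRoot f (parentVertex v z<s) (<-≤-trans (ParentOf⇒< (ParentOf-parentVertex v z<s)) (≤-pred v<f))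

  parentGraph-connected : Connected parentGraph
  parentGraph-connected u v = walkToRoot _ u ≤-refl ++ᵂ reverseᵂ (walkToRoot _ v ≤-refl)

  parentGraph-isTree : IsTree parentGraph
  parentGraph-isTree = s≤s z≤n , parentGraph-connected , parentGraph-acyclic

  private
    column-root : ∑[ i < suc m ] edgeTerm parentGraph i fzero ≡ 0
    column-root = sum-replicate-zero (suc m)

    column-child : ∀ j → ∑[ i < suc m ] edgeTerm parentGraph i (fsuc j) ≡ 1
    column-child j = begin
      ∑[ i < suc m ] edgeTerm parentGraph i (fsuc j)  ≡⟨ sum-suc-at _ (λ _ → 0) p termAtParent otherTerms ⟩
      suc (∑[ i < suc m ] 0)                          ≡⟨ cong suc (sum-replicate-zero (suc m)) ⟩
      1                                               ∎
      where
      open ≡-Reasoning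
      p = parentVertex (fsuc j) z<s
      p-parent = ParentOf-parentVertex (fsuc j) z<s
      termAtParent : edgeTerm parentGraph p (fsuc j) ≡ 1
      termAtParent rewrite <⇒<ᵇ≡true (ParentOf⇒< p-parent) | ParentOf⇒Adj p-parent = refl
      otherTerms : ∀ i → i ≢ p → edgeTerm parentGraph i (fsuc j) ≡ 0
      otherTerms i i≢p with toℕ i <ᵇ toℕ (fsuc j) in i<ᵇj | adj parentGraph i (fsuc j) in ij
      ... | false | _     = refl
      ... | true  | false = refl
      ... | true  | true  = contradiction (toℕ-injective (trans (smallerNeighbour ij (<ᵇ≡true⇒< i<ᵇj)) (sym (toℕ-fromℕ< _)))) i≢p

  edgeCount-parentGraph : edgeCount parentGraph ≡ m
  edgeCount-parentGraph = begin
    edgeCount parentGraph                                    ≡⟨ edgeCount≡∑ parentGraph ⟩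
    ∑[ i < suc m ] ∑[ j < suc m ] edgeTerm parentGraph i j   ≡⟨ ∑-comm (edgeTerm parentGraph) ⟩
    ∑[ j < suc m ] ∑[ i < suc m ] edgeTerm parentGraph i j   ≡⟨ cong₂ _+_ column-root (sum-cong-≗ column-child) ⟩
    ∑[ j < m ] 1                                             ≡⟨ ∑-one m ⟩
    m                                                        ∎
    where open ≡-Reasoning

-- Sharpness

∈⊤-y-w : {u y w : Fin n} → u ≢ y → u ≢ w → u ∈ (⊤ - y) - w
∈⊤-y-w u≢y u≢w = x∈p∧x≢y⇒x∈p-y (x∈p∧x≢y⇒x∈p-y ∈⊤ u≢y) u≢w

record SeparatedEdges (H : Graph n) : Set where
  field
    {x y z w} : Fin n
    xy  : Adj H x y
    zw  : Adj H z w
    y≢w : y ≢ w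
    x≢w : x ≢ w
    z≢y : z ≢ y

separatedEdges : (H : Graph n) {a b c d : Fin n} → Adj H a b → Adj H c d → ¬ SameEnds a b c d → SeparatedEdges H
separatedEdges H {a} {b} {c} {d} ab cd ¬same with b ≟ᶠ d | a ≟ᶠ d | b ≟ᶠ c
... | yes refl | _        | _        = record
  { xy = Adj-sym H ab ; zw = Adj-sym H cd ; y≢w = λ { refl → ¬same (inj₁ (refl , refl)) }
  ; x≢w = Adj⇒≢ H cd ∘ sym ; z≢y = Adj⇒≢ H ab ∘ sym }
... | no _     | yes refl | _        = record
  { xy = ab ; zw = Adj-sym H cd ; y≢w = λ { refl → ¬same (inj₂ (refl , refl)) }
  ; x≢w = Adj⇒≢ H cd ∘ sym ; z≢y = Adj⇒≢ H ab }
... | no _     | no _     | yes refl = record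
  { xy = Adj-sym H ab ; zw = cd ; y≢w = λ { refl → ¬same (inj₂ (refl , refl)) }
  ; x≢w = Adj⇒≢ H cd ; z≢y = Adj⇒≢ H ab ∘ sym }
... | no b≢d   | no a≢d   | no b≢c   = record
  { xy = ab ; zw = cd ; y≢w = b≢d ; x≢w = a≢d ; z≢y = b≢c ∘ sym }

Dominating-⊤-y-w : (H : Graph n) {x y z w : Fin n} → Adj H x y → Adj H z w → y ≢ w → x ≢ w → z ≢ y →
                   Dominating H ((⊤ - y) - w)
Dominating-⊤-y-w H {x} {y} {z} {w} xy zw y≢w x≢w z≢y v with v ≟ᶠ y | v ≟ᶠ w
... | yes refl | _        = inj₂ (x , ∈⊤-y-w (Adj⇒≢ H xy) x≢w , xy)
... | no _     | yes refl = inj₂ (z , ∈⊤-y-w z≢y (Adj⇒≢ H zw) , zw)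
... | no v≢y   | no v≢w   = inj₁ (∈⊤-y-w v≢y v≢w)

∣⊤-y-w∣ : ∀ {y w : Fin n} → y ≢ w → 2 + ∣ (⊤ - y) - w ∣ ≤ n
∣⊤-y-w∣ {n} {y} {w} y≢w = begin
  2 + ∣ (⊤ - y) - w ∣  ≤⟨ s≤s (x∈p⇒∣p-x∣<∣p∣ (x∈p∧x≢y⇒x∈p-y ∈⊤ (y≢w ∘ sym))) ⟩
  suc ∣ ⊤ - y ∣        ≤⟨ x∈p⇒∣p-x∣<∣p∣ {x = y} {p = ⊤ {n}} ∈⊤ ⟩
  ∣ ⊤ {n} ∣            ≡⟨ ∣⊤∣≡n n ⟩
  n                    ∎
  where open ≤-Reasoning

edgeCount≥1⇒edge : (H : Graph n) → 1 ≤ edgeCount H → ∃ λ a → ∃ λ b → Adj H a b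
edgeCount≥1⇒edge H 1≤e with edge? H
... | yes e = e
... | no none = contradiction (edgeCount-edgeless H λ i j ij → none (i , j , ij)) (<⇒≢ 1≤e ∘ sym)

domNum-twoEdges : (H : Graph n) → 2 ≤ edgeCount H → ∀ {h} → IsDomNum H h → 2 + h ≤ n
domNum-twoEdges H 2≤e (_ , min)
  with a , b , ab ← edgeCount≥1⇒edge H (≤-trans (s≤s z≤n) 2≤e)
  with c , d , cd′ ← edgeCount≥1⇒edge (H ─ edge a b (Adj⇒≢ H ab))
         (≤-pred (subst (2 ≤_) (edgeCount-OneEdgeMore (OneEdgeMore-─edge H ab)) 2≤e)) =
  ≤-trans (s≤s (s≤s (min _ (Dominating-⊤-y-w H xy zw y≢w x≢w z≢y)))) (∣⊤-y-w∣ y≢w)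
  where
  a≢b = Adj⇒≢ H ab
  cd = ─-⊆E H (edge a b a≢b) c d cd′
  ¬same : ¬ SameEnds a b c d
  ¬same same = ─-Adj⁻ H (edge a b a≢b) cd′ (edge-Adj⁺ a≢b same)
  open SeparatedEdges (separatedEdges H ab cd ¬same)

module Star (k : ℕ) where
  open ParentGraph k (λ _ → 0) (λ 0<b → 0<b) public

  domNum-star : IsDomNum parentGraph 1
  domNum-star = (⁅ fzero ⁆ , centre , ∣⁅x⁆∣≡1 {suc k} fzero) , λ D dom → [ ∈⇒1≤∣p∣ , ∈⇒1≤∣p∣ ∘ proj₁ ∘ proj₂ ]′ (dom fzero)
    where
    centre : Dominating parentGraph ⁅ fzero ⁆
    centre fzero    = inj₁ (x∈⁅x⁆ fzero)
    centre (fsuc v) = inj₂ (fzero , x∈⁅x⁆ fzero , ParentOf⇒Adj {fzero} {fsuc v} (z<s , refl))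

  star-hyp : Hyp k parentGraph
  star-hyp = parentGraph-isTree , ≤-reflexive (sym edgeCount-parentGraph) ,
             λ g γ → ≤-reflexive (cong (_+ k) (domNum-unique parentGraph γ domNum-star))

  deleteAll-raises : RaisesBy parentGraph parentGraph k
  deleteAll-raises = RaisesBy-intro parentGraph parentGraph domNum-star
    (domNum-edgeless (parentGraph ─ parentGraph) λ i j e → ─-Adj⁻ parentGraph parentGraph {i} {j} e (─-⊆E parentGraph parentGraph i j e))

  Sb-star : IsSb k parentGraph k
  Sb-star = subst (IsSb k parentGraph) (≤-antisym m≤k k≤m) sb
    where
    bounds = Sb-bounds k parentGraph star-hyp
    m = proj₁ bounds
    sb = proj₁ (proj₂ bounds)
    k≤m = proj₁ (proj₂ (proj₂ bounds))
    m≤k : m ≤ k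
    m≤k = subst (m ≤_) edgeCount-parentGraph (proj₂ sb parentGraph (λ _ _ e → e) deleteAll-raises)

-- The corona has vertices 0 … 2k + 1: the even ones form a path and 2j + 1 is a leaf at 2j. Both 2j + 1
-- and 2j + 2 have parent 2j, and spineIndex returns this j.
spineIndex : ℕ → ℕ
spineIndex 0 = 0
spineIndex 1 = 0
spineIndex 2 = 0
spineIndex (suc (suc (suc b))) = suc (spineIndex (suc b))

coronaParent : ℕ → ℕ
coronaParent b = 2 * spineIndex b

2*suc : ∀ t → 2 * suc t ≡ suc (suc (2 * t))
2*suc t = *-suc 2 t

coronaParent< : ∀ {b} → 0 < b → coronaParent b < b
coronaParent< {1} _ = z<s
coronaParent< {2} _ = z<s
coronaParent< {suc (suc (suc b))} _ =
  subst (_< 3 + b) (sym (2*suc (spineIndex (suc b)))) (s≤s (s≤s (coronaParent< {suc b} z<s)))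

spineIndex-leaf : ∀ t → spineIndex (suc (2 * t)) ≡ t
spineIndex-leaf zero = refl
spineIndex-leaf (suc t) rewrite 2*suc t = cong suc (spineIndex-leaf t)

coronaEdges : ℕ → ℕ
coronaEdges zero    = 1
coronaEdges (suc k) = suc (suc (coronaEdges k))

coronaEdges≡ : ∀ k → coronaEdges k ≡ suc (k + k)
coronaEdges≡ zero    = refl
coronaEdges≡ (suc k) = cong (suc ∘ suc) (trans (coronaEdges≡ k) (sym (+-suc k k)))

spineVertex : ∀ {k} → Fin (suc k) → Fin (suc (coronaEdges k))
spineVertex          fzero    = fzero
spineVertex {suc k} (fsuc j) = fsuc (fsuc (spineVertex j))

leafVertex : ∀ {k} → Fin (suc k) → Fin (suc (coronaEdges k))
leafVertex {zero}  fzero    = fsuc fzero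
leafVertex {suc k} fzero    = fsuc fzero
leafVertex {suc k} (fsuc j) = fsuc (fsuc (leafVertex j))

toℕ-spineVertex : ∀ {k} (j : Fin (suc k)) → toℕ (spineVertex j) ≡ 2 * toℕ j
toℕ-spineVertex          fzero    = refl
toℕ-spineVertex {suc k} (fsuc j) = trans (cong (suc ∘ suc) (toℕ-spineVertex j)) (sym (2*suc (toℕ j)))

toℕ-leafVertex : ∀ {k} (j : Fin (suc k)) → toℕ (leafVertex j) ≡ suc (2 * toℕ j)
toℕ-leafVertex {zero}  fzero    = refl
toℕ-leafVertex {suc k} fzero    = refl
toℕ-leafVertex {suc k} (fsuc j) = trans (cong (suc ∘ suc) (toℕ-leafVertex j)) (sym (cong suc (2*suc (toℕ j))))

vertexKinds : ∀ {k} (v : Fin (suc (coronaEdges k))) → ∃ λ j → v ≡ spineVertex j ⊎ v ≡ leafVertex j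
vertexKinds {zero}  fzero        = fzero , inj₁ refl
vertexKinds {zero}  (fsuc fzero) = fzero , inj₂ refl
vertexKinds {suc k} fzero        = fzero , inj₁ refl
vertexKinds {suc k} (fsuc fzero) = fzero , inj₂ refl
vertexKinds {suc k} (fsuc (fsuc v)) with vertexKinds v
... | j , inj₁ refl = fsuc j , inj₁ refl
... | j , inj₂ refl = fsuc j , inj₂ refl

spineSet : ∀ k → Subset (suc (coronaEdges k))
spineSet zero    = inside ∷ outside ∷ []
spineSet (suc k) = inside ∷ outside ∷ spineSet k

∣spineSet∣ : ∀ k → ∣ spineSet k ∣ ≡ suc k
∣spineSet∣ zero    = refl
∣spineSet∣ (suc k) = cong suc (∣spineSet∣ k)

spineVertex∈spineSet : ∀ {k} (j : Fin (suc k)) → spineVertex j ∈ spineSet k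
spineVertex∈spineSet {zero}  fzero    = Vec.here
spineVertex∈spineSet {suc k} fzero    = Vec.here
spineVertex∈spineSet {suc k} (fsuc j) = Vec.there (Vec.there (spineVertex∈spineSet j))

pairHit : ∀ {n x y} {p : Subset n} → fzero ∈ x ∷ y ∷ p ⊎ fsuc fzero ∈ x ∷ y ∷ p → suc ∣ p ∣ ≤ ∣ x ∷ y ∷ p ∣
pairHit {y = y} {p} (inj₁ Vec.here)         = s≤s (∣p∣≤∣x∷p∣ y p)
pairHit {x = x} {p = p} (inj₂ (Vec.there Vec.here)) = ∣p∣≤∣x∷p∣ x (inside ∷ p)

everyPairHit⇒≤ : ∀ {k} (D : Subset (suc (coronaEdges k))) → (∀ j → spineVertex j ∈ D ⊎ leafVertex j ∈ D) →
                 suc k ≤ ∣ D ∣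
everyPairHit⇒≤ {zero}  (_ ∷ _ ∷ []) hit = pairHit (hit fzero)
everyPairHit⇒≤ {suc k} (_ ∷ _ ∷ D)  hit = ≤-trans (s≤s (everyPairHit⇒≤ D hit′)) (pairHit (hit fzero))
  where
  hit′ : ∀ j → spineVertex j ∈ D ⊎ leafVertex j ∈ D
  hit′ j = map⊎ (drop-there ∘ drop-there) (drop-there ∘ drop-there) (hit (fsuc j))

module Corona (k : ℕ) where
  open ParentGraph (coronaEdges k) coronaParent coronaParent< public

  leafNeighbour : ∀ {u} (j : Fin (suc k)) → Adj parentGraph u (leafVertex j) → u ≡ spineVertex j
  leafNeighbour {u} j u-leaf with Adj⇒ParentOf u-leaf
  ... | inj₁ (_ , u≡) = toℕ-injective (begin
    toℕ u                                         ≡⟨ u≡ ⟩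
    2 * spineIndex (toℕ (leafVertex j))           ≡⟨ cong (λ t → 2 * spineIndex t) (toℕ-leafVertex j) ⟩
    2 * spineIndex (suc (2 * toℕ j))              ≡⟨ cong (2 *_) (spineIndex-leaf (toℕ j)) ⟩
    2 * toℕ j                                     ≡⟨ toℕ-spineVertex j ⟨
    toℕ (spineVertex j)                           ∎)
    where open ≡-Reasoning
  ... | inj₂ (_ , leaf≡) = contradiction (trans (sym leaf≡) (toℕ-leafVertex j)) (even≢odd (spineIndex (toℕ u)) (toℕ j))

  spine-leaf : (j : Fin (suc k)) → Adj parentGraph (spineVertex j) (leafVertex j)
  spine-leaf j = ParentOf⇒Adj {spineVertex j} {leafVertex j}
    ( subst (0 <_) (sym (toℕ-leafVertex j)) z<s
    , trans (toℕ-spineVertex j)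
            (sym (cong (2 *_) (trans (cong spineIndex (toℕ-leafVertex j)) (spineIndex-leaf (toℕ j))))) )

  domNum-corona : IsDomNum parentGraph (suc k)
  domNum-corona = (spineSet k , spinesDominate , ∣spineSet∣ k) , λ D dom → everyPairHit⇒≤ D (hit dom)
    where
    spinesDominate : Dominating parentGraph (spineSet k)
    spinesDominate v with vertexKinds v
    ... | j , inj₁ refl = inj₁ (spineVertex∈spineSet j)
    ... | j , inj₂ refl = inj₂ (spineVertex j , spineVertex∈spineSet j , spine-leaf j)
    hit : ∀ {D} → Dominating parentGraph D → ∀ j → spineVertex j ∈ D ⊎ leafVertex j ∈ D
    hit {D} dom j with dom (leafVertex j)
    ... | inj₁ leaf∈D = inj₂ leaf∈D
    ... | inj₂ (u , u∈D , u-leaf) = inj₁ (subst (_∈ D) (leafNeighbour j u-leaf) u∈D)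

  corona-hyp : Hyp k parentGraph
  corona-hyp = parentGraph-isTree , k≤edges , room
    where
    k≤edges : k ≤ edgeCount parentGraph
    k≤edges = subst (k ≤_) (sym (trans edgeCount-parentGraph (coronaEdges≡ k))) (≤-trans (m≤m+n k k) (n≤1+n _))
    room : ∀ g → IsDomNum parentGraph g → g + k ≤ suc (coronaEdges k)
    room g γ rewrite domNum-unique parentGraph γ domNum-corona | coronaEdges≡ k = n≤1+n _

  raising⇒2k≤ : ∀ F → F ⊆E parentGraph → RaisesBy parentGraph F k → 2 * k ≤ edgeCount F
  raising⇒2k≤ F F⊆T raises = ≮⇒≥ λ F<2k → <-irrefl refl (begin-strict
    suc (suc (suc k + k))                 ≤⟨ domNum-twoEdges (parentGraph ─ F) (2≤rest F<2k) (raises (suc k) domNum-corona) ⟩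
    suc (coronaEdges k)                   ≡⟨ cong suc (coronaEdges≡ k) ⟩
    suc (suc (k + k))                     <⟨ s≤s (s≤s (n<1+n _)) ⟩
    suc (suc (suc k + k))                 ∎)
    where
    open ≤-Reasoning
    split : suc (k + k) ≡ edgeCount (parentGraph ─ F) + edgeCount F
    split = trans (sym (trans edgeCount-parentGraph (coronaEdges≡ k))) (edgeCount-split parentGraph F F⊆T)
    2≤rest : edgeCount F < 2 * k → 2 ≤ edgeCount (parentGraph ─ F)
    2≤rest F<2k = ≮⇒≥ λ rest<2 → <-irrefl (sym split)
      (+-mono-≤-< (≤-pred rest<2) (subst (edgeCount F <_) (cong (k +_) (+-identityʳ k)) F<2k))

  Sb-corona : IsSb k parentGraph (2 * k)
  Sb-corona = subst (IsSb k parentGraph) (≤-antisym m≤2k (IsSb-≥ {G = parentGraph} sb raising⇒2k≤)) sb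
    where
    bounds = Sb-bounds k parentGraph corona-hyp
    sb = proj₁ (proj₂ bounds)
    m≤2k = proj₂ (proj₂ (proj₂ bounds))
corollary2 : (∀ (k : ℕ) → 1 ≤ k → ∀ {n} (T : Graph n) → Hyp k T → ∃ λ m → IsSb k T m × k ≤ m × m ≤ 2 * k) × (∀ (k : ℕ) → 1 ≤ k → (∃ λ n → Σ (Graph n) λ T₁ → Hyp k T₁ × IsSb k T₁ k) × (∃ λ n → Σ (Graph n) λ T₂ → Hyp k T₂ × IsSb k T₂ (2 * k)))
corollary2 = (λ k _ T → Sb-bounds k T) , λ k _ →
  (_ , Star.parentGraph k , Star.star-hyp k , Star.Sb-star k) ,
  (_ , Corona.parentGraph k , Corona.corona-hyp k , Corona.Sb-corona k)
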